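{- Let $T$ be a tree. Then (1) every maximum dissociation set of $T$ contains at least one end-vertex of each $\alpha_3$-critical edge of $T$; (2) a vertex of $T$ is flexible if and only if it is an end-vertex of an $\alpha_3$-critical edge of $T$.
   Context: A dissociation set of a graph $G$ is a set $S$ of vertices such that $G[S]$ has maximum degree at most $1$; a maximum dissociation set is one of maximum cardinality, which is denoted $\alpha_3(G)$. An edge $e$ is $\alpha_3$-critical if $\alpha_3(G-e)>\alpha_3(G)$, where $G-e$ is obtained by deleting $e$. A vertex is flexible if it belongs to some but not all maximum dissociation sets of $G$. -}

module Defs where

open import Data.Nat using (ℕ; zero; suc; _≤_; _<_; _⊔_)
open import Data.Bool using (Bool; true; false; _∧_; _∨_; not)
open import Data.Fin using (Fin; _≟_)
open import Data.Fin.Subset using (Subset; _∈_; _∉_; _∩_; ∣_∣)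
open import Data.Vec using (Vec; []; _∷_; tabulate)
open import Data.List using (List; []; _∷_; _++_; [_]; length; map; filter; foldr)
open import Data.List.Relation.Unary.Unique.Propositional using (Unique)
open import Data.Product using (Σ; ∃; ∃-syntax; _×_; _,_)
open import Relation.Binary.PropositionalEquality using (_≡_)
open import Relation.Nullary.Decidable using (Dec; ⌊_⌋)
open import Relation.Nullary using (¬_)

Graph : ℕ → Set
Graph n = Fin n → Fin n → Bool

IsSimple : ∀ {n} → Graph n → Set
IsSimple {n} G = (∀ (x y : Fin n) → G x y ≡ G y x) × (∀ (x : Fin n) → G x x ≡ false)

Chain : ∀ {n} → Graph n → List (Fin n) → Set
Chain G [] = Data.Unit.⊤ where import Data.Unit
Chain G (x ∷ []) = Data.Unit.⊤ where import Data.Unit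
Chain G (x ∷ y ∷ xs) = (G x y ≡ true) × Chain G (y ∷ xs)

data Walk {n} (G : Graph n) : Fin n → Fin n → Set where
  here : ∀ {u} → Walk G u u
  step : ∀ {u w v} → G u w ≡ true → Walk G w v → Walk G u v

Connected : ∀ {n} → Graph n → Set
Connected {n} G = ∀ (u v : Fin n) → Walk G u v

IsCycle : ∀ {n} → Graph n → Fin n → List (Fin n) → Set
IsCycle G x xs = (2 ≤ length xs) × Unique (x ∷ xs) × Chain G (x ∷ xs ++ [ x ])

Acyclic : ∀ {n} → Graph n → Set
Acyclic {n} G = ∀ (x : Fin n) (xs : List (Fin n)) → ¬ IsCycle G x xs

IsTree : ∀ {n} → Graph n → Set
IsTree G = Connected G × Acyclic G

nbhd : ∀ {n} → Graph n → Fin n → Subset n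
nbhd G v = tabulate (G v)

IsDissociation : ∀ {n} → Graph n → Subset n → Set
IsDissociation {n} G S = ∀ (v : Fin n) → v ∈ S → ∣ S ∩ nbhd G v ∣ ≤ 1

dissociation? : ∀ {n} (G : Graph n) (S : Subset n) → Dec (IsDissociation G S)
dissociation? {n} G S =
  Data.Fin.Properties.all? (λ v → Data.Fin.Subset.Properties._∈?_ v S
     Relation.Nullary.Decidable.→-dec Data.Nat.Properties._≤?_ ∣ S ∩ nbhd G v ∣ 1)
  where
  import Data.Fin.Properties
  import Data.Fin.Subset.Properties
  import Data.Nat.Properties
  import Relation.Nullary.Decidable

allSubsets : ∀ n → List (Subset n)
allSubsets zero = [] ∷ []
allSubsets (suc n) = map (true ∷_) (allSubsets n) ++ map (false ∷_) (allSubsets n)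

α₃ : ∀ {n} → Graph n → ℕ
α₃ {n} G = foldr _⊔_ 0 (map ∣_∣ (filter (dissociation? G) (allSubsets n)))

IsMaxDissociation : ∀ {n} → Graph n → Subset n → Set
IsMaxDissociation G S = IsDissociation G S × ∣ S ∣ ≡ α₃ G

deleteEdge : ∀ {n} → Graph n → Fin n → Fin n → Graph n
deleteEdge G u v x y =
  G x y ∧ not ((⌊ x ≟ u ⌋ ∧ ⌊ y ≟ v ⌋) ∨ (⌊ x ≟ v ⌋ ∧ ⌊ y ≟ u ⌋))

IsCriticalEdge : ∀ {n} → Graph n → Fin n → Fin n → Set
IsCriticalEdge G u v = (G u v ≡ true) × (α₃ G < α₃ (deleteEdge G u v))

IsFlexible : ∀ {n} → Graph n → Fin n → Set
IsFlexible {n} G v =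
  (∃[ S ] (IsMaxDissociation G S × v ∈ S)) × (∃[ S ] (IsMaxDissociation G S × v ∉ S))

-- For an edge vw of a tree T, let the branch at v containing w be the component of
-- T - vw containing w; the only edge leaving it is vw. Two dissociation sets can therefore
-- be spliced, one used inside the branch and the other outside, unless the first contains w
-- and the second v; the two splices of P and Q have total size |P| + |Q|.
--
-- (1) If a maximum set S missed both ends of a critical edge uv, splicing S with a maximum
-- set S' of T - uv in both ways would give two dissociation sets of T of total size
-- |S| + |S'| > 2 α₃(T).
-- (2) If vu is critical, a maximum set of T - vu has more than α₃(T) vertices, hence
-- contains v and u; deleting u, resp. v, from it yields maximum sets of T with and without v.
-- Conversely, let v lie in a maximum set P but not in a maximum set Q, take x ∈ Q \ P and the
-- branch at v containing x. Splicing Q inside with P outside is a dissociation set of T - vw;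
-- if it is larger than α₃(T) the edge vw is critical, otherwise the opposite splice is a
-- maximum set avoiding v that differs from P in fewer vertices than Q does, and we repeat.

module Submission where

open import Defs
open import Data.Bool using (Bool; true; false; _∧_; _∨_; not)
open import Data.Bool.Properties using (∧-comm; ∨-comm; ∧-zeroʳ; ∨-zeroʳ; ∧-identityʳ; T-≡)
open import Data.Empty using (⊥-elim)
open import Data.Fin using (Fin; zero; suc; _≟_)
open import Data.Fin.Subset
  using (Subset; inside; outside; _∈_; _∉_; _⊆_; _⊂_; _∩_; _∪_; ∁; ⁅_⁆; ∣_∣; ⊥)
open import Data.Fin.Subset.Properties
  using (_∈?_; nonempty?; p∩q⊆p; x∈p∩q⁺; x∈p∩q⁻; x∈p∪q⁻; x∈∁p⇒x∉p; x∉p⇒x∈∁p; x∈⁅x⁆; x≢y⇒x∉⁅y⁆;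
         p⊆q⇒∣p∣≤∣q∣; p⊂q⇒∣p∣<∣q∣; ∉⊥; ∣⊥∣≡0)
open import Data.List using (List; []; _∷_; _++_; [_]; map; filter; foldr)
import Data.List.Membership.Propositional as List
import Data.List.Membership.DecPropositional as DecList
open import Data.List.Membership.Propositional.Properties
  using (∈-map⁺; ∈-map⁻; ∈-filter⁺; ∈-filter⁻; ∈-++⁺ˡ; ∈-++⁺ʳ; foldr-selective)
open import Data.List.Properties using (foldr-forcesᵇ)
open import Data.List.Relation.Unary.All using (All; []; _∷_)
import Data.List.Relation.Unary.All as All
open import Data.List.Relation.Unary.All.Properties using (¬Any⇒All¬)
open import Data.List.Relation.Unary.AllPairs using ([]; _∷_)
open import Data.List.Relation.Unary.Any using (here; there)
open import Data.List.Relation.Unary.Unique.Propositional using (Unique)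
open import Data.Nat using (ℕ; suc; _+_; _≤_; _<_; _⊔_; z≤n; s≤s; _<?_)
open import Data.Nat.Properties
  using (≤-refl; ≤-trans; ≤-antisym; ≤-pred; n≤1+n; <-≤-trans; <⇒≱; <⇒≢; ≮⇒≥;
         +-mono-≤; +-monoˡ-≤; +-cancelˡ-≤; +-suc; m≤m⊔n; m≤n⊔m; ⊔-sel; module ≤-Reasoning)
open import Data.Product using (∃-syntax; _×_; _,_; proj₁; proj₂)
open import Data.Sum using (_⊎_; inj₁; inj₂)
import Data.Sum as Sum
open import Data.Vec using ([]; _∷_; tabulate)
open import Data.Vec.Properties using ([]=⇒lookup; lookup⇒[]=; lookup∘tabulate)
open import Function using (id)
open import Function.Bundles using (_⇔_; mk⇔; Equivalence)
open import Relation.Binary.PropositionalEquality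
  using (_≡_; _≢_; refl; sym; trans; cong; cong₂; subst; ≢-sym)
open import Relation.Nullary using (yes; no; contradiction)
open import Relation.Nullary.Decidable using (⌊_⌋; toWitness; fromWitness)

private
  variable
    n : ℕ
    G H : Graph n
    A P Q S X : Subset n
    u v w x y z : Fin n
    vs : List (Fin n)

∈∧∉⇒≢ : x ∈ P → y ∉ P → x ≢ y
∈∧∉⇒≢ x∈P y∉P refl = y∉P x∈P

x∉p∖x : ∀ (p : Subset n) x → x ∉ p ∩ ∁ ⁅ x ⁆
x∉p∖x p x x∈p∖x = x∈∁p⇒x∉p (proj₂ (x∈p∩q⁻ p (∁ ⁅ x ⁆) x∈p∖x)) (x∈⁅x⁆ x)

∣p∣≤∣p∩∁⊥∣ : ∀ (p : Subset n) → ∣ p ∣ ≤ ∣ p ∩ ∁ ⊥ ∣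
∣p∣≤∣p∩∁⊥∣ p = p⊆q⇒∣p∣≤∣q∣ p⊆p∩∁⊥
  where
  p⊆p∩∁⊥ : p ⊆ p ∩ ∁ ⊥
  p⊆p∩∁⊥ x∈p = x∈p∩q⁺ (x∈p , x∉p⇒x∈∁p ∉⊥)

∣p∣≤1+∣p∖x∣ : ∀ (p : Subset n) x → ∣ p ∣ ≤ suc ∣ p ∩ ∁ ⁅ x ⁆ ∣
∣p∣≤1+∣p∖x∣ (inside ∷ p) zero = s≤s (∣p∣≤∣p∩∁⊥∣ p)
∣p∣≤1+∣p∖x∣ (outside ∷ p) zero = ≤-trans (∣p∣≤∣p∩∁⊥∣ p) (n≤1+n _)
∣p∣≤1+∣p∖x∣ (inside ∷ p) (suc x) = s≤s (∣p∣≤1+∣p∖x∣ p x)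
∣p∣≤1+∣p∖x∣ (outside ∷ p) (suc x) = ∣p∣≤1+∣p∖x∣ p x

∈-tabulate⁻ : ∀ {f : Fin n → Bool} → x ∈ tabulate f → f x ≡ true
∈-tabulate⁻ {x = x} {f} x∈ = trans (sym (lookup∘tabulate f x)) ([]=⇒lookup x∈)

∈-tabulate⁺ : ∀ {f : Fin n → Bool} → f x ≡ true → x ∈ tabulate f
∈-tabulate⁺ {x = x} {f} fx = lookup⇒[]= x (tabulate f) (trans (lookup∘tabulate f x) fx)

splice : Subset n → Subset n → Subset n → Subset n
splice A P Q = (A ∩ P) ∪ (∁ A ∩ Q)

splice-inside : y ∈ A → y ∈ splice A P Q → y ∈ P
splice-inside {A = A} {P = P} {Q = Q} y∈A y∈X with x∈p∪q⁻ (A ∩ P) (∁ A ∩ Q) y∈X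
... | inj₁ y∈A∩P = proj₂ (x∈p∩q⁻ A P y∈A∩P)
... | inj₂ y∈∁A∩Q = contradiction y∈A (x∈∁p⇒x∉p (proj₁ (x∈p∩q⁻ (∁ A) Q y∈∁A∩Q)))

splice-outside : y ∉ A → y ∈ splice A P Q → y ∈ Q
splice-outside {A = A} {P = P} {Q = Q} y∉A y∈X with x∈p∪q⁻ (A ∩ P) (∁ A ∩ Q) y∈X
... | inj₁ y∈A∩P = contradiction (proj₁ (x∈p∩q⁻ A P y∈A∩P)) y∉A
... | inj₂ y∈∁A∩Q = proj₂ (x∈p∩q⁻ (∁ A) Q y∈∁A∩Q)

+-suc-cong : ∀ {a b c d} → a + b ≡ c + d → a + suc b ≡ c + suc d
+-suc-cong {a} {b} {c} {d} eq = trans (+-suc a b) (trans (cong suc eq) (sym (+-suc c d)))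

∣splice∣+∣splice∣≡∣P∣+∣Q∣ : ∀ (A P Q : Subset n) →
  ∣ splice A P Q ∣ + ∣ splice A Q P ∣ ≡ ∣ P ∣ + ∣ Q ∣
∣splice∣+∣splice∣≡∣P∣+∣Q∣ [] [] [] = refl
∣splice∣+∣splice∣≡∣P∣+∣Q∣ (a ∷ A) (p ∷ P) (q ∷ Q) with ∣splice∣+∣splice∣≡∣P∣+∣Q∣ A P Q
∣splice∣+∣splice∣≡∣P∣+∣Q∣ (a ∷ A) (p ∷ P) (q ∷ Q) | ih with a | p | q
... | inside  | inside  | inside  = cong suc (+-suc-cong ih)
... | inside  | inside  | outside = cong suc ih
... | inside  | outside | inside  = +-suc-cong ih
... | inside  | outside | outside = ih
... | outside | inside  | inside  = cong suc (+-suc-cong ih)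
... | outside | inside  | outside = trans (+-suc _ _) (cong suc ih)
... | outside | outside | inside  = trans (cong suc ih) (sym (+-suc _ _))
... | outside | outside | outside = ih

splice-closer : x ∈ A → x ∈ Q ∩ ∁ P → splice A P Q ∩ ∁ P ⊂ Q ∩ ∁ P
splice-closer {x = x} {A = A} {Q = Q} {P = P} x∈A x∈Q∖P = Y∖P⊆Q∖P , x , x∈Q∖P , x∉Y∖P
  where
  x∉Y∖P : x ∉ splice A P Q ∩ ∁ P
  x∉Y∖P x∈Y∖P = let x∈Y , x∈∁P = x∈p∩q⁻ (splice A P Q) (∁ P) x∈Y∖P
                in x∈∁p⇒x∉p x∈∁P (splice-inside x∈A x∈Y)
  Y∖P⊆Q∖P : splice A P Q ∩ ∁ P ⊆ Q ∩ ∁ P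
  Y∖P⊆Q∖P {y} y∈Y∖P with x∈p∩q⁻ (splice A P Q) (∁ P) y∈Y∖P | y ∈? A
  ... | y∈Y , y∈∁P | yes y∈A = contradiction (splice-inside y∈A y∈Y) (x∈∁p⇒x∉p y∈∁P)
  ... | y∈Y , y∈∁P | no y∉A = x∈p∩q⁺ (splice-outside y∉A y∈Y , y∈∁P)

∣Q∣≤-from-splices : ∀ {m} (A P Q : Subset n) → ∣ splice A P Q ∣ ≤ m → ∣ splice A Q P ∣ ≤ m →
                    ∣ P ∣ ≡ m → ∣ Q ∣ ≤ m
∣Q∣≤-from-splices {m = m} A P Q X≤m Y≤m ∣P∣≡m = +-cancelˡ-≤ m ∣ Q ∣ m (begin
  m + ∣ Q ∣                           ≡⟨ cong (_+ ∣ Q ∣) (sym ∣P∣≡m) ⟩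
  ∣ P ∣ + ∣ Q ∣                       ≡⟨ sym (∣splice∣+∣splice∣≡∣P∣+∣Q∣ A P Q) ⟩
  ∣ splice A P Q ∣ + ∣ splice A Q P ∣ ≤⟨ +-mono-≤ X≤m Y≤m ⟩
  m + m                               ∎)
  where open ≤-Reasoning

∣splice∣≥-from-swap : ∀ {m} (A P Q : Subset n) → ∣ P ∣ ≡ m → ∣ Q ∣ ≡ m →
                      ∣ splice A Q P ∣ ≤ m → m ≤ ∣ splice A P Q ∣
∣splice∣≥-from-swap {m = m} A P Q ∣P∣≡m ∣Q∣≡m Y≤m = +-cancelˡ-≤ m m ∣ splice A P Q ∣ (begin
  m + m                               ≡⟨ sym (cong₂ _+_ ∣Q∣≡m ∣P∣≡m) ⟩
  ∣ Q ∣ + ∣ P ∣                       ≡⟨ sym (∣splice∣+∣splice∣≡∣P∣+∣Q∣ A Q P) ⟩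
  ∣ splice A Q P ∣ + ∣ splice A P Q ∣ ≤⟨ +-monoˡ-≤ _ Y≤m ⟩
  m + ∣ splice A P Q ∣                ∎)
  where open ≤-Reasoning

∈-nbhd⁻ : z ∈ nbhd G y → G y z ≡ true
∈-nbhd⁻ = ∈-tabulate⁻

∈-nbhd⁺ : G y z ≡ true → z ∈ nbhd G y
∈-nbhd⁺ = ∈-tabulate⁺

degree≤1 : IsDissociation H P → y ∈ P →
           (∀ {z} → z ∈ X → G y z ≡ true → z ∈ P × H y z ≡ true) →
           ∣ X ∩ nbhd G y ∣ ≤ 1
degree≤1 {H = H} {P = P} {y = y} {X = X} {G = G} dP y∈P neighbour =
  ≤-trans (p⊆q⇒∣p∣≤∣q∣ X∩N⊆P∩N) (dP y y∈P)
  where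
  X∩N⊆P∩N : X ∩ nbhd G y ⊆ P ∩ nbhd H y
  X∩N⊆P∩N z∈X∩N =
    let z∈X , z∈N = x∈p∩q⁻ X (nbhd G y) z∈X∩N
        z∈P , Hyz = neighbour z∈X (∈-nbhd⁻ {G = G} z∈N)
    in x∈p∩q⁺ (z∈P , ∈-nbhd⁺ {G = H} Hyz)

splice-dissociation : ∀ {G₁ G₂ : Graph n} → (∀ y z → G y z ≡ G z y) →
  IsDissociation G₁ P → IsDissociation G₂ Q →
  (∀ {y z} → y ∈ A → z ∈ A → G y z ≡ true → G₁ y z ≡ true) →
  (∀ {y z} → y ∉ A → z ∉ A → G y z ≡ true → G₂ y z ≡ true) →
  (∀ {y z} → y ∈ A → y ∈ P → z ∉ A → z ∈ Q → G y z ≢ true) →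
  IsDissociation G (splice A P Q)
splice-dissociation {G = G} {P = P} {Q = Q} {A = A} {G₁} {G₂}
                    G-sym dP dQ edges-inside edges-outside no-crossing y y∈X with y ∈? A
... | yes y∈A = degree≤1 {G = G} dP (splice-inside y∈A y∈X) neighbour
  where
  neighbour : ∀ {z} → z ∈ splice A P Q → G y z ≡ true → z ∈ P × G₁ y z ≡ true
  neighbour {z} z∈X Gyz with z ∈? A
  ... | yes z∈A = splice-inside z∈A z∈X , edges-inside y∈A z∈A Gyz
  ... | no z∉A =
    contradiction Gyz (no-crossing y∈A (splice-inside y∈A y∈X) z∉A (splice-outside z∉A z∈X))
... | no y∉A = degree≤1 {G = G} dQ (splice-outside y∉A y∈X) neighbour
  where
  neighbour : ∀ {z} → z ∈ splice A P Q → G y z ≡ true → z ∈ Q × G₂ y z ≡ true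
  neighbour {z} z∈X Gyz with z ∈? A
  ... | yes z∈A = contradiction (trans (G-sym z y) Gyz)
                    (no-crossing z∈A (splice-inside z∈A z∈X) y∉A (splice-outside y∉A y∈X))
  ... | no z∉A = splice-outside z∉A z∈X , edges-outside y∉A z∉A Gyz

deleteEdge-⊆ : deleteEdge G u v y z ≡ true → G y z ≡ true
deleteEdge-⊆ {G = G} {y = y} {z = z} e with G y z
... | true = refl
... | false = e

deleteEdge-removes : ∀ (G : Graph n) u v → deleteEdge G u v v u ≡ false
deleteEdge-removes G u v with v ≟ v | u ≟ u
... | yes _ | yes _ rewrite ∨-zeroʳ (⌊ v ≟ u ⌋ ∧ ⌊ u ≟ v ⌋) = ∧-zeroʳ (G v u)
... | no v≢v | _ = contradiction refl v≢v
... | _ | no u≢u = contradiction refl u≢u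

deleteEdge-avoidingˡ : y ≢ u → z ≢ u → deleteEdge G u v y z ≡ G y z
deleteEdge-avoidingˡ {y = y} {u = u} {z = z} {G = G} {v = v} y≢u z≢u
  with y ≟ u | z ≟ u | y ≟ v
... | yes y≡u | _ | _ = contradiction y≡u y≢u
... | no _ | yes z≡u | _ = contradiction z≡u z≢u
... | no _ | no _ | yes _ = ∧-identityʳ (G y z)
... | no _ | no _ | no _ = ∧-identityʳ (G y z)

deleteEdge-avoidingʳ : y ≢ v → z ≢ v → deleteEdge G u v y z ≡ G y z
deleteEdge-avoidingʳ {y = y} {v = v} {z = z} {G = G} {u = u} y≢v z≢v
  with y ≟ v | z ≟ v | y ≟ u
... | yes y≡v | _ | _ = contradiction y≡v y≢v
... | no _ | yes z≡v | _ = contradiction z≡v z≢v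
... | no _ | no _ | yes _ = ∧-identityʳ (G y z)
... | no _ | no _ | no _ = ∧-identityʳ (G y z)

deleteEdge-sym : (∀ y z → G y z ≡ G z y) → ∀ y z → deleteEdge G u v y z ≡ deleteEdge G u v z y
deleteEdge-sym {u = u} {v = v} G-sym y z =
  cong₂ _∧_ (G-sym y z) (cong not (trans
    (∨-comm (⌊ y ≟ u ⌋ ∧ ⌊ z ≟ v ⌋) (⌊ y ≟ v ⌋ ∧ ⌊ z ≟ u ⌋))
    (cong₂ _∨_ (∧-comm ⌊ y ≟ v ⌋ ⌊ z ≟ u ⌋) (∧-comm ⌊ y ≟ u ⌋ ⌊ z ≟ v ⌋))))

dissociation-without-endpoint : IsDissociation (deleteEdge G u v) S → X ⊆ S → u ∉ X ⊎ v ∉ X →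
                                IsDissociation G X
dissociation-without-endpoint {G = G} {u = u} {v = v} {X = X} dS X⊆S u∉X⊎v∉X y y∈X =
  degree≤1 {G = G} dS (X⊆S y∈X) λ z∈X Gyz → X⊆S z∈X , trans (kept y∈X z∈X u∉X⊎v∉X) Gyz
  where
  kept : y ∈ X → z ∈ X → u ∉ X ⊎ v ∉ X → deleteEdge G u v y z ≡ G y z
  kept y∈X z∈X (inj₁ u∉X) = deleteEdge-avoidingˡ {G = G} {v = v} (∈∧∉⇒≢ y∈X u∉X) (∈∧∉⇒≢ z∈X u∉X)
  kept y∈X z∈X (inj₂ v∉X) = deleteEdge-avoidingʳ {G = G} {u = u} (∈∧∉⇒≢ y∈X v∉X) (∈∧∉⇒≢ z∈X v∉X)

∈-allSubsets : ∀ (p : Subset n) → p List.∈ allSubsets n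
∈-allSubsets [] = here refl
∈-allSubsets (inside ∷ p) = ∈-++⁺ˡ (∈-map⁺ (inside ∷_) (∈-allSubsets p))
∈-allSubsets {suc n} (outside ∷ p) =
  ∈-++⁺ʳ (map (inside ∷_) (allSubsets n)) (∈-map⁺ (outside ∷_) (∈-allSubsets p))

∈⇒≤foldr-⊔ : ∀ {m} {ms : List ℕ} → m List.∈ ms → m ≤ foldr _⊔_ 0 ms
∈⇒≤foldr-⊔ {ms = ms} m∈ms = All.lookup (foldr-forcesᵇ split 0 ms ≤-refl) m∈ms
  where
  split : ∀ a b → a ⊔ b ≤ foldr _⊔_ 0 ms → a ≤ foldr _⊔_ 0 ms × b ≤ foldr _⊔_ 0 ms
  split a b a⊔b≤ = ≤-trans (m≤m⊔n a b) a⊔b≤ , ≤-trans (m≤n⊔m a b) a⊔b≤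

∣S∣≤α₃ : IsDissociation G S → ∣ S ∣ ≤ α₃ G
∣S∣≤α₃ {G = G} {S = S} dS =
  ∈⇒≤foldr-⊔ (∈-map⁺ ∣_∣ (∈-filter⁺ (dissociation? G) {xs = allSubsets _} (∈-allSubsets S) dS))

maxDissociation-exists : ∀ (G : Graph n) → ∃[ S ] IsMaxDissociation G S
maxDissociation-exists {n} G
  with foldr-selective ⊔-sel 0 (map ∣_∣ (filter (dissociation? G) (allSubsets n)))
... | inj₁ α₃≡0 = ⊥ , (λ _ v∈⊥ → contradiction v∈⊥ ∉⊥) , trans (∣⊥∣≡0 n) (sym α₃≡0)
... | inj₂ α₃∈sizes =
  let S , S∈ , α₃≡∣S∣ = ∈-map⁻ ∣_∣ α₃∈sizes
  in S , proj₂ (∈-filter⁻ (dissociation? G) {xs = allSubsets n} S∈) , sym α₃≡∣S∣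

adjacent⇒≢ : (∀ x → G x x ≡ false) → G x y ≡ true → x ≢ y
adjacent⇒≢ {x = x} loopless Gxy refl with trans (sym Gxy) (loopless x)
... | ()

critical⇒flexible : (∀ x → G x x ≡ false) → IsCriticalEdge G v u → IsFlexible G v
critical⇒flexible {G = G} {v = v} {u = u} loopless (Gvu , α<α′)
  with maxDissociation-exists (deleteEdge G v u)
... | S′ , dS′ , ∣S′∣≡α′ =
  (S′ ∩ ∁ ⁅ u ⁆ , max-without u (inj₂ (x∉p∖x S′ u)) , v∈S′∖u) ,
  (S′ ∩ ∁ ⁅ v ⁆ , max-without v (inj₁ (x∉p∖x S′ v)) , x∉p∖x S′ v)
  where
  α<∣S′∣ : α₃ G < ∣ S′ ∣
  α<∣S′∣ = subst (α₃ G <_) (sym ∣S′∣≡α′) α<α′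

  -- Removing one vertex from S′ loses at most one element, hence lands exactly on α₃ G.
  max-without : ∀ x → v ∉ S′ ∩ ∁ ⁅ x ⁆ ⊎ u ∉ S′ ∩ ∁ ⁅ x ⁆ → IsMaxDissociation G (S′ ∩ ∁ ⁅ x ⁆)
  max-without x endpoint∉ =
    d , ≤-antisym (∣S∣≤α₃ d) (≤-pred (≤-trans α<∣S′∣ (∣p∣≤1+∣p∖x∣ S′ x)))
    where
    d : IsDissociation G (S′ ∩ ∁ ⁅ x ⁆)
    d = dissociation-without-endpoint dS′ (p∩q⊆p S′ (∁ ⁅ x ⁆)) endpoint∉

  v∈S′ : v ∈ S′
  v∈S′ with v ∈? S′
  ... | yes v∈S′ = v∈S′
  ... | no v∉S′ =
    contradiction (∣S∣≤α₃ (dissociation-without-endpoint dS′ id (inj₁ v∉S′))) (<⇒≱ α<∣S′∣)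

  v∈S′∖u : v ∈ S′ ∩ ∁ ⁅ u ⁆
  v∈S′∖u = x∈p∩q⁺ (v∈S′ , x∉p⇒x∈∁p (x≢y⇒x∉⁅y⁆ (adjacent⇒≢ {G = G} loopless Gvu)))

walk-trans : Walk G x y → Walk G y z → Walk G x z
walk-trans here q = q
walk-trans (step e p) q = step e (walk-trans p q)

walk-reverse : (∀ {y z} → G y z ≡ true → G z y ≡ true) → Walk G x y → Walk G y x
walk-reverse G-sym here = here
walk-reverse G-sym (step e p) = walk-trans (walk-reverse G-sym p) (step (G-sym e) here)

data Path (G : Graph n) : Fin n → Fin n → List (Fin n) → Set where
  nil : Path G x x []
  cons : G x y ≡ true → Path G y z vs → Path G x z (y ∷ vs)

path-from : Path G y z vs → x List.∈ (y ∷ vs) → Unique (y ∷ vs) →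
            ∃[ ws ] (Path G x z ws × Unique (x ∷ ws))
path-from p (here refl) unique = _ , p , unique
path-from (cons e p) (there x∈vs) (_ ∷ unique) = path-from p x∈vs unique

walk⇒path : Walk G x y → ∃[ vs ] (Path G x y vs × Unique (x ∷ vs))
walk⇒path here = [] , nil , [] ∷ []
walk⇒path {x = x} (step {w = c} e walk) with walk⇒path walk
... | vs , p , unique with DecList._∈?_ _≟_ x (c ∷ vs)
...   | yes x∈ = path-from p x∈ unique
...   | no x∉ = c ∷ vs , cons e p , ¬Any⇒All¬ (c ∷ vs) x∉ ∷ unique

opaque
  deleteVertex : Graph n → Fin n → Graph n
  deleteVertex G v y z = not ⌊ y ≟ v ⌋ ∧ not ⌊ z ≟ v ⌋ ∧ G y z

opaque
  unfolding deleteVertex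

  deleteVertex⁺ : y ≢ v → z ≢ v → G y z ≡ true → deleteVertex G v y z ≡ true
  deleteVertex⁺ {y = y} {v = v} {z = z} y≢v z≢v Gyz with y ≟ v | z ≟ v
  ... | yes y≡v | _ = contradiction y≡v y≢v
  ... | no _ | yes z≡v = contradiction z≡v z≢v
  ... | no _ | no _ = Gyz

  deleteVertex⁻ : deleteVertex G v y z ≡ true → y ≢ v × z ≢ v × G y z ≡ true
  deleteVertex⁻ {v = v} {y = y} {z = z} e with y ≟ v | z ≟ v
  deleteVertex⁻ () | yes _ | _
  deleteVertex⁻ () | no _ | yes _
  deleteVertex⁻ e | no y≢v | no z≢v = y≢v , z≢v , e

deleteVertex-sym : (∀ y z → G y z ≡ G z y) →
                   deleteVertex G v y z ≡ true → deleteVertex G v z y ≡ true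
deleteVertex-sym {y = y} {z = z} G-sym e =
  let y≢v , z≢v , Gyz = deleteVertex⁻ e in deleteVertex⁺ z≢v y≢v (trans (G-sym z y) Gyz)

path-avoids : Path (deleteVertex G v) x y vs → All (v ≢_) vs
path-avoids nil = []
path-avoids (cons e p) = (λ v≡ → proj₁ (proj₂ (deleteVertex⁻ e)) (sym v≡)) ∷ path-avoids p

path-chain : Path (deleteVertex G v) x y vs → G y v ≡ true → Chain G (x ∷ vs ++ [ v ])
path-chain nil Gyv = Gyv , _
path-chain (cons e p) Gyv = proj₂ (proj₂ (deleteVertex⁻ e)) , path-chain p Gyv

walk-to-neighbour : Walk G x v → x ≢ v → ∃[ w ] (G w v ≡ true × Walk (deleteVertex G v) x w)
walk-to-neighbour here x≢v = contradiction refl x≢v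
walk-to-neighbour {x = x} {v = v} (step {w = y} Gxy walk) x≢v with y ≟ v
... | yes refl = x , Gxy , here
... | no y≢v =
  let w , Gwv , walk′ = walk-to-neighbour walk y≢v
  in w , Gwv , step (deleteVertex⁺ x≢v y≢v Gxy) walk′

-- Two neighbours of v joined in G - v close a cycle through v.
neighbours-separated : IsSimple G → Acyclic G → G y v ≡ true → G w v ≡ true →
                       Walk (deleteVertex G v) y w → y ≡ w
neighbours-separated {y = y} {v = v} (G-sym , loopless) acyclic Gyv Gwv walk with walk⇒path walk
... | [] , nil , _ = refl
... | c ∷ vs , p , unique =
  ⊥-elim (acyclic v (y ∷ c ∷ vs)
    (s≤s (s≤s z≤n) , (v∉ ∷ unique) , trans (G-sym v y) Gyv , path-chain p Gwv))
  where
  v∉ : All (v ≢_) (y ∷ c ∷ vs)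
  v∉ = (λ v≡y → adjacent⇒≢ loopless Gyv (sym v≡y)) ∷ path-avoids p

module _ {n} {T : Graph n} (simple : IsSimple T) (tree : IsTree T) where

  private
    T-sym : ∀ {y z} → T y z ≡ true → T z y ≡ true
    T-sym {y} {z} Tyz = trans (proj₁ simple z y) Tyz

  -- The neighbour of v on the path from x to v (junk value v when x = v).
  towards : Fin n → Fin n → Fin n
  towards v x with x ≟ v
  ... | yes _ = v
  ... | no x≢v = proj₁ (walk-to-neighbour (proj₁ tree x v) x≢v)

  towards-self : towards v v ≡ v
  towards-self {v = v} with v ≟ v
  ... | yes _ = refl
  ... | no v≢v = contradiction refl v≢v

  towards-spec : x ≢ v → T (towards v x) v ≡ true × Walk (deleteVertex T v) x (towards v x)
  towards-spec {x = x} {v = v} x≢v with x ≟ v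
  ... | yes x≡v = contradiction x≡v x≢v
  ... | no x≢v′ = proj₂ (walk-to-neighbour (proj₁ tree x v) x≢v′)

  towards-unique : x ≢ v → T w v ≡ true → Walk (deleteVertex T v) x w → towards v x ≡ w
  towards-unique x≢v Twv walk =
    let Tw′v , walk′ = towards-spec x≢v
    in neighbours-separated simple (proj₂ tree) Tw′v Twv
         (walk-trans (walk-reverse (deleteVertex-sym (proj₁ simple)) walk′) walk)

  -- The component of T - vw containing w, when w is a neighbour of v.
  branch : Fin n → Fin n → Subset n
  branch v w = tabulate λ x → ⌊ towards v x ≟ w ⌋

  ∈-branch⁺ : towards v x ≡ w → x ∈ branch v w
  ∈-branch⁺ eq = ∈-tabulate⁺ (Equivalence.to T-≡ (fromWitness eq))

  ∈-branch⁻ : x ∈ branch v w → towards v x ≡ w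
  ∈-branch⁻ x∈ = toWitness (Equivalence.from T-≡ (∈-tabulate⁻ x∈))

  branch-∋ : T w v ≡ true → w ∈ branch v w
  branch-∋ Twv = ∈-branch⁺ (towards-unique (adjacent⇒≢ (proj₂ simple) Twv) Twv here)

  branch-∌ : T w v ≡ true → v ∉ branch v w
  branch-∌ {v = v} Twv v∈ =
    adjacent⇒≢ {G = T} (proj₂ simple) Twv (trans (sym (∈-branch⁻ v∈)) (towards-self {v = v}))

  branch-boundary : T w v ≡ true → T y z ≡ true → y ∈ branch v w → z ∉ branch v w →
                    y ≡ w × z ≡ v
  branch-boundary {w = w} {v = v} {y = y} {z = z} Twv Tyz y∈A z∉A with z ≟ v
  ... | yes refl = trans (sym (towards-unique y≢v Tyz here)) (∈-branch⁻ y∈A) , refl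
    where
    y≢v : y ≢ v
    y≢v refl = branch-∌ Twv y∈A
  ... | no z≢v = contradiction (∈-branch⁺ (towards-unique z≢v Twv walk)) z∉A
    where
    y≢v : y ≢ v
    y≢v refl = branch-∌ Twv y∈A
    walk : Walk (deleteVertex T v) z w
    walk = step (deleteVertex⁺ z≢v y≢v (T-sym Tyz))
                (subst (Walk _ y) (∈-branch⁻ y∈A) (proj₂ (towards-spec y≢v)))

  critical-edge-meets-max : ∀ u v → IsCriticalEdge T u v →
                            ∀ S → IsMaxDissociation T S → u ∈ S ⊎ v ∈ S
  critical-edge-meets-max u v (Tuv , α<α′) S (dS , ∣S∣≡α) with u ∈? S | v ∈? S
  ... | yes u∈S | _ = inj₁ u∈S
  ... | no _ | yes v∈S = inj₂ v∈S
  ... | no u∉S | no v∉S with maxDissociation-exists (deleteEdge T u v)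
  ...   | S′ , dS′ , ∣S′∣≡α′ =
    contradiction (∣Q∣≤-from-splices side S S′ (∣S∣≤α₃ dX) (∣S∣≤α₃ dY) ∣S∣≡α)
                  (<⇒≱ (subst (α₃ T <_) (sym ∣S′∣≡α′) α<α′))
    where
    side : Subset n
    side = branch v u
    u∈side : u ∈ side
    u∈side = branch-∋ Tuv
    v∉side : v ∉ side
    v∉side = branch-∌ Tuv

    dX : IsDissociation T (splice side S S′)
    dX = splice-dissociation (proj₁ simple) dS dS′ (λ _ _ → id) kept crossing
      where
      kept : y ∉ side → z ∉ side → T y z ≡ true → deleteEdge T u v y z ≡ true
      kept y∉A z∉A Tyz =
        trans (deleteEdge-avoidingˡ {G = T} {v = v} (≢-sym (∈∧∉⇒≢ u∈side y∉A))
                                                    (≢-sym (∈∧∉⇒≢ u∈side z∉A))) Tyz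
      crossing : y ∈ side → y ∈ S → z ∉ side → z ∈ S′ → T y z ≢ true
      crossing y∈A y∈S z∉A _ Tyz = u∉S (subst (_∈ S) (proj₁ (branch-boundary Tuv Tyz y∈A z∉A)) y∈S)

    dY : IsDissociation T (splice side S′ S)
    dY = splice-dissociation (proj₁ simple) dS′ dS kept (λ _ _ → id) crossing
      where
      kept : y ∈ side → z ∈ side → T y z ≡ true → deleteEdge T u v y z ≡ true
      kept y∈A z∈A Tyz =
        trans (deleteEdge-avoidingʳ {G = T} {u = u} (∈∧∉⇒≢ y∈A v∉side) (∈∧∉⇒≢ z∈A v∉side)) Tyz
      crossing : y ∈ side → y ∈ S′ → z ∉ side → z ∈ S → T y z ≢ true
      crossing y∈A _ z∉A z∈S Tyz = v∉S (subst (_∈ S) (proj₂ (branch-boundary Tuv Tyz y∈A z∉A)) z∈S)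

  splice-branch-dissociation : T w v ≡ true → IsDissociation T P → IsDissociation T Q → v ∉ Q →
                               IsDissociation T (splice (branch v w) P Q)
  splice-branch-dissociation {w = w} {v = v} {Q = Q} Twv dP dQ v∉Q =
    splice-dissociation (proj₁ simple) dP dQ (λ _ _ → id) (λ _ _ → id) crossing
    where
    crossing : y ∈ branch v w → y ∈ P → z ∉ branch v w → z ∈ Q → T y z ≢ true
    crossing y∈A _ z∉A z∈Q Tyz = v∉Q (subst (_∈ Q) (proj₂ (branch-boundary Twv Tyz y∈A z∉A)) z∈Q)

  splice-branch-dissociation-deleteEdge :
    T w v ≡ true → IsDissociation T P → IsDissociation T Q →
    IsDissociation (deleteEdge T v w) (splice (branch v w) P Q)
  splice-branch-dissociation-deleteEdge {w = w} {v = v} Twv dP dQ =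
    splice-dissociation (deleteEdge-sym (proj₁ simple)) dP dQ
      (λ _ _ → deleteEdge-⊆ {G = T}) (λ _ _ → deleteEdge-⊆ {G = T}) crossing
    where
    crossing : y ∈ branch v w → y ∈ P → z ∉ branch v w → z ∈ Q → deleteEdge T v w y z ≢ true
    crossing y∈A _ z∉A _ Dyz with branch-boundary Twv (deleteEdge-⊆ {G = T} Dyz) y∈A z∉A
    ... | refl , refl with trans (sym Dyz) (deleteEdge-removes T v w)
    ...   | ()

  CloserWithout : Fin n → Subset n → Subset n → Set
  CloserWithout v P Q = ∃[ Q′ ] (IsMaxDissociation T Q′ × v ∉ Q′ × ∣ Q′ ∩ ∁ P ∣ < ∣ Q ∩ ∁ P ∣)

  exchange-across : T w v ≡ true → x ∈ branch v w → x ∈ Q ∩ ∁ P →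
                    IsMaxDissociation T P → IsMaxDissociation T Q → v ∉ Q →
                    IsCriticalEdge T v w ⊎ CloserWithout v P Q
  exchange-across {w = w} {v = v} {Q = Q} {P = P} Twv x∈A x∈Q∖P (dP , ∣P∣≡α) (dQ , ∣Q∣≡α) v∉Q
    with α₃ T <? ∣ splice (branch v w) Q P ∣
  ... | yes α<∣X∣ =
    inj₁ (T-sym Twv , <-≤-trans α<∣X∣ (∣S∣≤α₃ (splice-branch-dissociation-deleteEdge Twv dQ dP)))
  ... | no α≮∣X∣ = inj₂ (Y , (dY , ∣Y∣≡α) , v∉Y , p⊂q⇒∣p∣<∣q∣ (splice-closer x∈A x∈Q∖P))
    where
    Y : Subset n
    Y = splice (branch v w) P Q
    dY : IsDissociation T Y
    dY = splice-branch-dissociation Twv dP dQ v∉Q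
    ∣Y∣≡α : ∣ Y ∣ ≡ α₃ T
    ∣Y∣≡α = ≤-antisym (∣S∣≤α₃ dY) (∣splice∣≥-from-swap (branch v w) P Q ∣P∣≡α ∣Q∣≡α (≮⇒≥ α≮∣X∣))
    v∉Y : v ∉ Y
    v∉Y v∈Y = v∉Q (splice-outside (branch-∌ Twv) v∈Y)

  exchange-step : IsMaxDissociation T P → v ∈ P → IsMaxDissociation T Q → v ∉ Q →
                  (∃[ u ] IsCriticalEdge T v u) ⊎ CloserWithout v P Q
  exchange-step {P = P} {v = v} {Q = Q} maxP v∈P maxQ v∉Q with nonempty? (Q ∩ ∁ P)
  ... | yes (x , x∈Q∖P) =
    let Twv , _ = towards-spec (∈∧∉⇒≢ (proj₁ (x∈p∩q⁻ Q (∁ P) x∈Q∖P)) v∉Q)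
    in Sum.map₁ (towards v x ,_) (exchange-across Twv (∈-branch⁺ refl) x∈Q∖P maxP maxQ v∉Q)
  ... | no Q∖P-empty = contradiction (trans (proj₂ maxQ) (sym (proj₂ maxP)))
                                     (<⇒≢ (p⊂q⇒∣p∣<∣q∣ (Q⊆P , v , v∈P , v∉Q)))
    where
    Q⊆P : Q ⊆ P
    Q⊆P {y} y∈Q with y ∈? P
    ... | yes y∈P = y∈P
    ... | no y∉P = contradiction (y , x∈p∩q⁺ (y∈Q , x∉p⇒x∈∁p y∉P)) Q∖P-empty

  flexible⇒critical : IsFlexible T v → ∃[ u ] IsCriticalEdge T v u
  flexible⇒critical {v = v} ((P , maxP , v∈P) , (Q , maxQ , v∉Q)) =
    descend (suc ∣ Q ∩ ∁ P ∣) Q maxQ v∉Q ≤-refl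
    where
    descend : ∀ k Q → IsMaxDissociation T Q → v ∉ Q → ∣ Q ∩ ∁ P ∣ < k → ∃[ u ] IsCriticalEdge T v u
    descend (suc k) Q maxQ v∉Q bound with exchange-step maxP v∈P maxQ v∉Q
    ... | inj₁ critical = critical
    ... | inj₂ (Q′ , maxQ′ , v∉Q′ , closer) =
      descend k Q′ maxQ′ v∉Q′ (<-≤-trans closer (≤-pred bound))

theorem3p5 : ∀ {n} (T : Graph n) → IsSimple T → IsTree T →
    (∀ (u v : Fin n) → IsCriticalEdge T u v →
       ∀ (S : Subset n) → IsMaxDissociation T S → u ∈ S ⊎ v ∈ S)
    × (∀ (v : Fin n) → IsFlexible T v ⇔ (∃[ u ] IsCriticalEdge T v u))
theorem3p5 T simple tree =
  critical-edge-meets-max simple tree ,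
  λ v → mk⇔ (flexible⇒critical simple tree)
             λ (_ , critical) → critical⇒flexible (proj₂ simple) critical
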